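{- For positive integers $i,r,s$ and integers $a\ge0$ define $$c_{i,r,s,a}=\sum_{\ell\ge0}\sum_{d\ge0}\sum_{k\ge0}(-1)^{r+s-\ell-d}\binom r\ell\binom sd\binom\ell k\binom dk\binom{\ell+d-k}{a}k!\,i^k.$$ Then $$\mathbf{p}_{i^r}\mathbf{p}_{i^s}=\sum_{a=0}^{r+s}c_{i,r,s,a}\,\mathbf{p}_{i^a}.$$ Moreover, if $\lambda$ is a partition with $m_i(\lambda)=0$, then $\mathbf{p}_{i^r}\mathbf{p}_\lambda=\mathbf{p}_{(i^r)\cup\lambda}$, where $(i^r)\cup\lambda$ is obtained by adding $r$ parts equal to $i$ to $\lambda$.
   Context: $Sym=\mathbb{Q}[p_1,p_2,\ldots]$ is the ring of symmetric functions (power sum generators $p_k$). For $i\ge1$ let $q_i=\frac1i\sum_{d\mid i}\mathrm{mob}(i/d)\,p_d$, where $\mathrm{mob}$ is the number-theoretic Möbius function, and let $(x)_r=x(x-1)\cdots(x-r+1)$ be the falling factorial. For $i,r\ge1$ set $\overline{\mathbf{p}}_{i^r}=i^r\,(q_i)_r$, and $\overline{\mathbf{p}}_{i^0}=1$; set $\mathbf{p}_{i^r}=\sum_{k=0}^r(-1)^{r-k}\binom rk\overline{\mathbf{p}}_{i^k}$ (so $\mathbf{p}_{i^0}=1$). For a partition $\gamma$ with $m_i(\gamma)$ parts equal to $i$, $\mathbf{p}_\gamma=\prod_{i\ge1}\mathbf{p}_{i^{m_i(\gamma)}}$. -}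

module Defs where

open import Data.Nat as ℕ using (ℕ; zero; suc; _≡ᵇ_; _!)
open import Data.Nat.Divisibility using (_∣?_)
open import Data.Nat.Primality using (prime?)
open import Data.Nat.Combinatorics using (_C_)
open import Data.Integer as ℤ using (ℤ; +_)
open import Data.Rational as ℚ using (ℚ; 0ℚ; 1ℚ; _/_)
open import Data.List using (List; []; _∷_; map; concatMap; filter; length; foldr; replicate; _++_; upTo)
open import Data.Product using (_×_; _,_)
open import Data.Bool using (Bool; true; false; _∧_; if_then_else_)
open import Relation.Binary.PropositionalEquality using (_≡_)

-- The polynomial ring Sym = ℚ[p₁, p₂, …] realised concretely.
-- A monomial is an exponent list: position j holds the exponent of p_{j+1}
-- (lists equal up to trailing zeros denote the same monomial).

Mono : Set
Mono = List ℕ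

Sym : Set
Sym = List (ℚ × Mono)

eqMono : Mono → Mono → Bool
eqMono []       []       = true
eqMono []       (y ∷ ys) = (y ≡ᵇ 0) ∧ eqMono [] ys
eqMono (x ∷ xs) []       = (x ≡ᵇ 0) ∧ eqMono xs []
eqMono (x ∷ xs) (y ∷ ys) = (x ≡ᵇ y) ∧ eqMono xs ys

coeff : Sym → Mono → ℚ
coeff []             m = 0ℚ
coeff ((a , m') ∷ f) m = (if eqMono m' m then a else 0ℚ) ℚ.+ coeff f m

infix 4 _≈_
_≈_ : Sym → Sym → Set
f ≈ g = ∀ m → coeff f m ≡ coeff g m

addMono : Mono → Mono → Mono
addMono []       ys       = ys
addMono (x ∷ xs) []       = x ∷ xs
addMono (x ∷ xs) (y ∷ ys) = (x ℕ.+ y) ∷ addMono xs ys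

infixl 6 _⊕_
infixl 7 _⊗_ _·_

_⊕_ : Sym → Sym → Sym
f ⊕ g = f ++ g

_⊗_ : Sym → Sym → Sym
f ⊗ g = concatMap (λ { (a , m) → map (λ { (b , n) → (a ℚ.* b , addMono m n) }) g }) f

_·_ : ℚ → Sym → Sym
c · f = map (λ { (a , m) → (c ℚ.* a , m) }) f

const : ℚ → Sym
const c = (c , []) ∷ []

one : Sym
one = const 1ℚ

-- the generator p_k (k ≥ 1); p 0 is unused and set to 0
p : ℕ → Sym
p zero    = []
p (suc j) = (1ℚ , replicate j 0 ++ (1 ∷ [])) ∷ []

ℕ→ℚ : ℕ → ℚ
ℕ→ℚ n = (+ n) / 1

ℤ→ℚ : ℤ → ℚ
ℤ→ℚ z = z / 1

oneTo : ℕ → List ℕ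
oneTo n = map suc (upTo n)

mob : ℕ → ℤ
mob zero = + 0
mob n@(suc _) with length (filter (λ d → (d ℕ.* d) ∣? n) (filter (λ d → 2 ℕ.≤? d) (oneTo n)))
... | suc _ = + 0
... | zero  = (ℤ.- (+ 1)) ℤ.^ length (filter (λ d → d ∣? n) (filter prime? (oneTo n)))

sumSym : List Sym → Sym
sumSym = foldr _⊕_ []

-- q_i = (1/i) Σ_{d ∣ i} mob(i/d) p_d   (q_0 := 0, never used)
-- (d ranges over suc e for e < i with suc e ∣ i)
q : ℕ → Sym
q zero = []
q i@(suc _) = ((+ 1) / i) ·
  sumSym (map (λ e → ℤ→ℚ (mob (i ℕ./ suc e)) · p (suc e))
              (filter (λ e → suc e ∣? i) (upTo i)))

falling : Sym → ℕ → Sym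
falling x zero    = one
falling x (suc r) = falling x r ⊗ (x ⊕ const (ℚ.- ℕ→ℚ r))

Σ≤ : ℕ → (ℕ → Sym) → Sym
Σ≤ n f = sumSym (map f (upTo (suc n)))

pbar : ℕ → ℕ → Sym
pbar i zero    = one
pbar i r@(suc _) = ℕ→ℚ (i ℕ.^ r) · falling (q i) r

sgn : ℕ → ℤ
sgn n = (ℤ.- (+ 1)) ℤ.^ n

bp : ℕ → ℕ → Sym
bp i r = Σ≤ r (λ k → ℤ→ℚ (sgn (r ℕ.∸ k) ℤ.* (+ (r C k))) · pbar i k)

-- Partitions in multiplicity notation: a list m with m[j] = m_{j+1}(γ),
-- the number of parts equal to j+1 (trailing zeros are immaterial).

Partition : Set
Partition = List ℕ

mult : ℕ → Partition → ℕ
mult zero    γ        = 0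
mult (suc _) []       = 0
mult 1       (m ∷ γ)  = m
mult (suc (suc j)) (m ∷ γ) = mult (suc j) γ

addParts : ℕ → ℕ → Partition → Partition
addParts zero    r γ       = γ
addParts 1       r []      = r ∷ []
addParts 1       r (m ∷ γ) = (r ℕ.+ m) ∷ γ
addParts (suc (suc j)) r []      = 0 ∷ addParts (suc j) r []
addParts (suc (suc j)) r (m ∷ γ) = m ∷ addParts (suc j) r γ

bpPart' : ℕ → Partition → Sym
bpPart' i []      = one
bpPart' i (m ∷ γ) = bp i m ⊗ bpPart' (suc i) γ

bpPart : Partition → Sym
bpPart = bpPart' 1

-- The coefficients c_{i,r,s,a}
-- Σ_{ℓ≤r} Σ_{d≤s} Σ_{k≤ℓ} (-1)^{r+s-ℓ-d} C(r,ℓ) C(s,d) C(ℓ,k) C(d,k) C(ℓ+d-k,a) k! i^k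
-- (terms outside these ranges vanish since the binomials are 0)

Σℤ≤ : ℕ → (ℕ → ℤ) → ℤ
Σℤ≤ n f = foldr ℤ._+_ (+ 0) (map f (upTo (suc n)))

cCoef : ℕ → ℕ → ℕ → ℕ → ℤ
cCoef i r s a =
  Σℤ≤ r λ ℓ → Σℤ≤ s λ d → Σℤ≤ ℓ λ k →
    sgn ((r ℕ.+ s) ℕ.∸ (ℓ ℕ.+ d)) ℤ.*
    (+ ((r C ℓ) ℕ.* (s C d) ℕ.* (ℓ C k) ℕ.* (d C k)
        ℕ.* (((ℓ ℕ.+ d) ℕ.∸ k) C a) ℕ.* (k !) ℕ.* (i ℕ.^ k)))

module Submission where

-- Write x = q_i.  Then p̄_{i^n} = i^n (x)_n and 𝐩_{i^r} is the alternating
-- binomial transform Σ_k (-1)^{r-k} C(r,k) p̄_{i^k}.  The first identity is an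
-- identity in any commutative ring, for any element x:
--   * falling factorials multiply by (x)_a (x)_b = Σ_k C(a,k) C(b,k) k! (x)_{a+b-k};
--   * binomial inversion gives p̄_{i^N} = Σ_a C(N,a) 𝐩_{i^a};
-- so expanding 𝐩_{i^r} 𝐩_{i^s} bilinearly in the p̄'s, multiplying the p̄'s and
-- re-expanding in the 𝐩's yields exactly the coefficients c_{i,r,s,a}.

open import Level using (Level; 0ℓ)
open import Data.Bool using (Bool; true; false; _∧_; if_then_else_)
open import Data.Bool.Properties using (∧-identityʳ; ∧-zeroʳ)
open import Data.Nat as ℕ using (ℕ; zero; suc; _≡ᵇ_; _∸_; _≤_; _<_; z≤n; s≤s; _^_; _!)
import Data.Nat.Properties as ℕP
open import Data.Nat.Combinatorics using (_C_; nCk+nC[k+1]≡[n+1]C[k+1])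
open import Data.Nat.Tactic.RingSolver using (solve-∀)
import Data.Nat.Coprimality as Coprime
open import Data.Integer as ℤ using (ℤ; +_; -[1+_])
import Data.Integer.Properties as ℤP
import Data.Integer.Solver as ℤSolver
open import Data.Rational as ℚ using (ℚ; mkℚ; 0ℚ; 1ℚ)
import Data.Rational.Properties as ℚP
import Data.Rational.Solver as ℚSolver
open import Data.Fin using (toℕ)
open import Data.Fin.Properties using (toℕ<n)
open import Data.List using ([]; _∷_; map; foldr; applyUpTo; upTo)
open import Data.List.Properties using (++-assoc; map-upTo)
open import Data.Product using (_×_; _,_)
open import Algebra.Bundles using (CommutativeRing)
open import Relation.Nullary using (yes; no)
open import Relation.Binary.PropositionalEquality as ≡ using (_≡_; module ≡-Reasoning)
import Defs
open Defs using (sgn)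

module RangeSums {c ℓ : Level} (R : CommutativeRing c ℓ) where
  open CommutativeRing R
  open import Algebra.Properties.Semiring.Sum semiring
    using (sum; sum-cong-≋; sum-replicate-zero; ∑-distrib-+; ∑-comm; *-distribˡ-sum)

  -- Σ is opaque so that unification never sees through the Fin-indexed
  -- sum; it is used only through the lemmas below.
  opaque
    Σ : ℕ → (ℕ → Carrier) → Carrier
    Σ n f = sum {n} (λ k → f (toℕ k))

  opaque
    unfolding Σ

    Σ-empty : ∀ f → Σ 0 f ≈ 0#
    Σ-empty f = refl

    Σ-suc : ∀ n f → Σ (suc n) f ≈ f 0 + Σ n (λ k → f (suc k))
    Σ-suc n f = refl

    Σ-cong : ∀ n {f g} → (∀ k → k < n → f k ≈ g k) → Σ n f ≈ Σ n g
    Σ-cong n e = sum-cong-≋ (λ k → e (toℕ k) (toℕ<n k))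

    Σ-cong′ : ∀ n {f g} → (∀ k → f k ≈ g k) → Σ n f ≈ Σ n g
    Σ-cong′ n e = Σ-cong n (λ k _ → e k)

    Σ-zero : ∀ n → Σ n (λ _ → 0#) ≈ 0#
    Σ-zero n = sum-replicate-zero n

    Σ-+ : ∀ n f g → Σ n (λ k → f k + g k) ≈ Σ n f + Σ n g
    Σ-+ n f g = ∑-distrib-+ {n} (λ k → f (toℕ k)) (λ k → g (toℕ k))

    Σ-*ˡ : ∀ n c f → c * Σ n f ≈ Σ n (λ k → c * f k)
    Σ-*ˡ n c f = *-distribˡ-sum {n} c (λ k → f (toℕ k))

    Σ-*ʳ : ∀ n c f → Σ n f * c ≈ Σ n (λ k → f k * c)
    Σ-*ʳ n c f = trans (*-comm _ c) (trans (Σ-*ˡ n c f) (Σ-cong′ n (λ k → *-comm c (f k))))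

    Σ-swap : ∀ n m (f : ℕ → ℕ → Carrier) → Σ n (λ a → Σ m (f a)) ≈ Σ m (λ b → Σ n (λ a → f a b))
    Σ-swap n m f = ∑-comm {n} {m} (λ a b → f (toℕ a) (toℕ b))

    Σ-extend : ∀ n N f → n ≤ N → (∀ k → n ≤ k → f k ≈ 0#) → Σ n f ≈ Σ N f
    Σ-extend zero    N       f _         vanish =
      trans (sym (Σ-zero N)) (Σ-cong′ N (λ k → sym (vanish k z≤n)))
    Σ-extend (suc n) (suc N) f (s≤s n≤N) vanish =
      +-congˡ (Σ-extend n N (λ k → f (suc k)) n≤N (λ k n≤k → vanish (suc k) (s≤s n≤k)))

module Binomials where
  open ≡ using (refl; sym; trans; cong; cong₂)
  open ℤSolver.+-*-Solver
  open ≡-Reasoning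

  -- Binomial coefficients by Pascal's rule; this agrees with the library's
  -- `_C_` (`bin≡C`) but unfolds by pattern matching.
  bin : ℕ → ℕ → ℕ
  bin _       zero    = 1
  bin zero    (suc k) = 0
  bin (suc n) (suc k) = bin n k ℕ.+ bin n (suc k)

  bin≡C : ∀ n k → bin n k ≡ n C k
  bin≡C n       zero    = refl
  bin≡C zero    (suc k) = refl
  bin≡C (suc n) (suc k) =
    trans (cong₂ ℕ._+_ (bin≡C n k) (bin≡C n (suc k))) (nCk+nC[k+1]≡[n+1]C[k+1] n k)

  bin-vanish : ∀ a k → a < k → bin a k ≡ 0
  bin-vanish zero    (suc k) _         = refl
  bin-vanish (suc a) (suc k) (s≤s a<k) =
    cong₂ ℕ._+_ (bin-vanish a k a<k) (bin-vanish a (suc k) (ℕP.m<n⇒m<1+n a<k))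

  bin-1 : ∀ a → bin a 1 ≡ a
  bin-1 zero    = refl
  bin-1 (suc a) = cong suc (bin-1 a)

  bin-absorb : ∀ a k → + bin a k ℤ.* (+ a ℤ.- + k) ≡ + bin a (suc k) ℤ.* + suc k
  bin-absorb zero    zero    = refl
  bin-absorb zero    (suc k) = refl
  bin-absorb (suc a) zero    = begin
    + 1 ℤ.* (+ suc a ℤ.- + 0) ≡⟨ solve 1 (λ x → con (+ 1) :* (x :- con (+ 0)) := x :* con (+ 1)) refl (+ suc a) ⟩
    + suc a ℤ.* + 1           ≡⟨ cong (λ u → + suc u ℤ.* + 1) (sym (bin-1 a)) ⟩
    + suc (bin a 1) ℤ.* + 1   ∎
  bin-absorb (suc a) (suc k) = begin
    + (x ℕ.+ y) ℤ.* (+ suc a ℤ.- + suc k)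
      ≡⟨ cong₂ ℤ._*_ (ℤP.pos-+ x y) (shift a k) ⟩
    (+ x ℤ.+ + y) ℤ.* (+ a ℤ.- + k)
      ≡⟨ solve 4 (λ x y a k → (x :+ y) :* (a :- k) := x :* (a :- k) :+ y :* (a :- k)) refl (+ x) (+ y) (+ a) (+ k) ⟩
    + x ℤ.* (+ a ℤ.- + k) ℤ.+ + y ℤ.* (+ a ℤ.- + k)
      ≡⟨ cong (ℤ._+ + y ℤ.* (+ a ℤ.- + k)) (trans (bin-absorb a k) (cong (+ y ℤ.*_) (ℤP.pos-+ 1 k))) ⟩
    + y ℤ.* (+ 1 ℤ.+ + k) ℤ.+ + y ℤ.* (+ a ℤ.- + k)
      ≡⟨ solve 3 (λ y a k → y :* (con (+ 1) :+ k) :+ y :* (a :- k)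
                          := y :* (con (+ 1) :+ (con (+ 1) :+ k)) :+ y :* (a :- (con (+ 1) :+ k)))
               refl (+ y) (+ a) (+ k) ⟩
    + y ℤ.* (+ 1 ℤ.+ (+ 1 ℤ.+ + k)) ℤ.+ + y ℤ.* (+ a ℤ.- (+ 1 ℤ.+ + k))
      ≡⟨ cong₂ (λ u v → + y ℤ.* u ℤ.+ + y ℤ.* (+ a ℤ.- v))
           (sym (trans (ℤP.pos-+ 1 (suc k)) (cong (λ u → + 1 ℤ.+ u) (ℤP.pos-+ 1 k)))) (sym (ℤP.pos-+ 1 k)) ⟩
    + y ℤ.* + suc (suc k) ℤ.+ + y ℤ.* (+ a ℤ.- + suc k)
      ≡⟨ cong (λ u → + y ℤ.* + suc (suc k) ℤ.+ u) (bin-absorb a (suc k)) ⟩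
    + y ℤ.* + suc (suc k) ℤ.+ + z ℤ.* + suc (suc k)
      ≡⟨ sym (trans (cong (ℤ._* + suc (suc k)) (ℤP.pos-+ y z)) (ℤP.*-distribʳ-+ (+ suc (suc k)) (+ y) (+ z))) ⟩
    + (y ℕ.+ z) ℤ.* + suc (suc k) ∎
    where
    x = bin a k
    y = bin a (suc k)
    z = bin a (suc (suc k))
    shift : ∀ a k → + suc a ℤ.- + suc k ≡ + a ℤ.- + k
    shift a k = trans (cong₂ ℤ._-_ (ℤP.pos-+ 1 a) (ℤP.pos-+ 1 k))
      (solve 2 (λ a k → (con (+ 1) :+ a) :- (con (+ 1) :+ k) := a :- k) refl (+ a) (+ k))

  sgn-suc : ∀ n → sgn (suc n) ≡ ℤ.- sgn n
  sgn-suc n = ℤP.-1*i≡-i (sgn n)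

  sgn-+ : ∀ m n → sgn (m ℕ.+ n) ≡ sgn m ℤ.* sgn n
  sgn-+ m n = ℤP.^-distribˡ-+-* (ℤ.- (+ 1)) m n

  sgn-∸-+ : ∀ r s l d → l ≤ r → d ≤ s → sgn ((r ℕ.+ s) ∸ (l ℕ.+ d)) ≡ sgn (r ∸ l) ℤ.* sgn (s ∸ d)
  sgn-∸-+ r s l d l≤r d≤s = trans (cong sgn exponent) (sgn-+ (r ∸ l) (s ∸ d))
    where
    exponent : (r ℕ.+ s) ∸ (l ℕ.+ d) ≡ (r ∸ l) ℕ.+ (s ∸ d)
    exponent = trans (sym (ℕP.∸-+-assoc (r ℕ.+ s) l d))
      (trans (cong (_∸ d) (ℕP.+-∸-comm s l≤r)) (ℕP.+-∸-assoc (r ∸ l) d≤s))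

  -- The signed binomial (-1)^{a-k} C(a,k): the entries of the inverse of
  -- Pascal's matrix.  It satisfies a signed Pascal rule in the row index.
  sbin : ℕ → ℕ → ℤ
  sbin a k = sgn (a ∸ k) ℤ.* + bin a k

  sbin-vanish : ∀ a k → a < k → sbin a k ≡ + 0
  sbin-vanish a k a<k =
    trans (cong (λ u → sgn (a ∸ k) ℤ.* + u) (bin-vanish a k a<k)) (ℤP.*-zeroʳ (sgn (a ∸ k)))

  sbin-pascal₀ : ∀ a → sbin a 0 ℤ.+ sbin (suc a) 0 ≡ + 0
  sbin-pascal₀ a = trans (cong (λ u → sgn a ℤ.* + 1 ℤ.+ u ℤ.* + 1) (sgn-suc a))
    (solve 1 (λ s → s :* con (+ 1) :+ (:- s) :* con (+ 1) := con (+ 0)) refl (sgn a))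

  sbin-pascal : ∀ a k → sbin a (suc k) ℤ.+ sbin (suc a) (suc k) ≡ sbin a k
  sbin-pascal a k with k ℕP.<? a
  ... | yes k<a = begin
    s ℤ.* + y ℤ.+ sgn (a ∸ k) ℤ.* + (x ℕ.+ y)
      ≡⟨ cong₂ (λ u v → s ℤ.* + y ℤ.+ u ℤ.* v) flip (ℤP.pos-+ x y) ⟩
    s ℤ.* + y ℤ.+ ℤ.- s ℤ.* (+ x ℤ.+ + y)
      ≡⟨ solve 3 (λ s x y → s :* y :+ (:- s) :* (x :+ y) := (:- s) :* x) refl s (+ x) (+ y) ⟩
    ℤ.- s ℤ.* + x
      ≡⟨ cong (ℤ._* + x) (sym flip) ⟩
    sgn (a ∸ k) ℤ.* + x ∎
    where
    x = bin a k
    y = bin a (suc k)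
    s = sgn (a ∸ suc k)
    flip : sgn (a ∸ k) ≡ ℤ.- s
    flip = trans (cong sgn (ℕP.+-∸-assoc 1 k<a)) (sgn-suc (a ∸ suc k))
  ... | no k≮a = begin
    sgn (a ∸ suc k) ℤ.* + y ℤ.+ sgn (a ∸ k) ℤ.* + (x ℕ.+ y)
      ≡⟨ cong (λ u → sgn (a ∸ suc k) ℤ.* + u ℤ.+ sgn (a ∸ k) ℤ.* + (x ℕ.+ u)) y≡0 ⟩
    sgn (a ∸ suc k) ℤ.* + 0 ℤ.+ sgn (a ∸ k) ℤ.* + (x ℕ.+ 0)
      ≡⟨ cong (λ u → sgn (a ∸ suc k) ℤ.* + 0 ℤ.+ sgn (a ∸ k) ℤ.* + u) (ℕP.+-identityʳ x) ⟩
    sgn (a ∸ suc k) ℤ.* + 0 ℤ.+ sgn (a ∸ k) ℤ.* + x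
      ≡⟨ solve 2 (λ s t → s :* con (+ 0) :+ t := t) refl (sgn (a ∸ suc k)) (sgn (a ∸ k) ℤ.* + x) ⟩
    sgn (a ∸ k) ℤ.* + x ∎
    where
    x = bin a k
    y = bin a (suc k)
    y≡0 : y ≡ 0
    y≡0 = bin-vanish a (suc k) (s≤s (ℕP.≮⇒≥ k≮a))

  -- The number C(a,k) C(b,k) k! of partial matchings of size k between an
  -- a-set and a b-set; `matchings⁺ a b k` counts those of size k+1 between
  -- an a-set and a (b+1)-set that use the new element.
  matchings : ℕ → ℕ → ℕ → ℕ
  matchings a b k = bin a k ℕ.* bin b k ℕ.* (k !)

  matchings⁺ : ℕ → ℕ → ℕ → ℕ
  matchings⁺ a b k = bin a (suc k) ℕ.* bin b k ℕ.* (suc k !)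

  matchings-vanish : ∀ a b k → b < k → matchings a b k ≡ 0
  matchings-vanish a b k b<k rewrite bin-vanish b k b<k | ℕP.*-zeroʳ (bin a k) = refl

  -- Matchings of size k+1 with a (b+1)-set either avoid or use the new element.
  matchings-pascal : ∀ a b k → matchings a (suc b) (suc k) ≡ matchings a b (suc k) ℕ.+ matchings⁺ a b k
  matchings-pascal a b k = split (bin a (suc k)) (bin b k) (bin b (suc k)) (suc k !)
    where
    split : ∀ A B₀ B₁ F → A ℕ.* (B₀ ℕ.+ B₁) ℕ.* F ≡ A ℕ.* B₁ ℕ.* F ℕ.+ A ℕ.* B₀ ℕ.* F
    split = solve-∀

  matchings-absorb : ∀ a b k → k ≤ b →
    + matchings a b k ℤ.* (+ (b ℕ.+ a ∸ k) ℤ.- + b) ≡ + matchings⁺ a b k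
  matchings-absorb a b k k≤b = begin
    + matchings a b k ℤ.* (+ (b ℕ.+ a ∸ k) ℤ.- + b)
      ≡⟨ cong₂ (λ u v → u ℤ.* (v ℤ.- + b)) (pos-*₃ X Y F) b+a-k ⟩
    + X ℤ.* + Y ℤ.* + F ℤ.* (+ b ℤ.+ + a ℤ.- + k ℤ.- + b)
      ≡⟨ solve 6 (λ X Y F a b k → X :* Y :* F :* (b :+ a :- k :- b) := X :* (a :- k) :* Y :* F)
               refl (+ X) (+ Y) (+ F) (+ a) (+ b) (+ k) ⟩
    + X ℤ.* (+ a ℤ.- + k) ℤ.* + Y ℤ.* + F
      ≡⟨ cong (λ u → u ℤ.* + Y ℤ.* + F) (bin-absorb a k) ⟩
    + Z ℤ.* + suc k ℤ.* + Y ℤ.* + F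
      ≡⟨ solve 4 (λ Z S Y F → Z :* S :* Y :* F := Z :* Y :* (S :* F)) refl (+ Z) (+ suc k) (+ Y) (+ F) ⟩
    + Z ℤ.* + Y ℤ.* (+ suc k ℤ.* + F)
      ≡⟨ sym (trans (ℤP.pos-* (Z ℕ.* Y) (suc k ℕ.* F)) (cong₂ ℤ._*_ (ℤP.pos-* Z Y) (ℤP.pos-* (suc k) F))) ⟩
    + matchings⁺ a b k ∎
    where
    X = bin a k
    Y = bin b k
    F = k !
    Z = bin a (suc k)
    pos-*₃ : ∀ p q r → + (p ℕ.* q ℕ.* r) ≡ + p ℤ.* + q ℤ.* + r
    pos-*₃ p q r = trans (ℤP.pos-* (p ℕ.* q) r) (cong (ℤ._* + r) (ℤP.pos-* p q))
    b+a-k : + (b ℕ.+ a ∸ k) ≡ + b ℤ.+ + a ℤ.- + k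
    b+a-k = trans (sym (trans (ℤP.m-n≡m⊖n (b ℕ.+ a) k) (ℤP.⊖-≥ (ℕP.≤-trans k≤b (ℕP.m≤m+n b a)))))
                  (cong (ℤ._- + k) (ℤP.pos-+ b a))

open Binomials

module WithIntegers {c ℓ : Level} (R : CommutativeRing c ℓ) (ι : ℤ → CommutativeRing.Carrier R)
  (ι-+ : ∀ a b → CommutativeRing._≈_ R (ι (a ℤ.+ b)) (CommutativeRing._+_ R (ι a) (ι b)))
  (ι-* : ∀ a b → CommutativeRing._≈_ R (ι (a ℤ.* b)) (CommutativeRing._*_ R (ι a) (ι b)))
  (ι-1 : CommutativeRing._≈_ R (ι (+ 1)) (CommutativeRing.1# R))
  (ι-0 : CommutativeRing._≈_ R (ι (+ 0)) (CommutativeRing.0# R)) where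

  open CommutativeRing R
  open RangeSums R public
  open import Relation.Binary.Reasoning.Setoid setoid

  ι-cong : ∀ {a b} → a ≡ b → ι a ≈ ι b
  ι-cong e = reflexive (≡.cong ι e)

  B : ℕ → ℕ → Carrier
  B n k = ι (+ bin n k)

  B-vanish : ∀ n k → n < k → B n k ≈ 0#
  B-vanish n k n<k = trans (ι-cong (≡.cong +_ (bin-vanish n k n<k))) ι-0

  Σ-pascal : ∀ n (g : ℕ → Carrier) →
    Σ (suc (suc n)) (λ a → B (suc n) a * g a) ≈ Σ (suc n) (λ a → B n a * (g a + g (suc a)))
  Σ-pascal n g = begin
    Σ (suc (suc n)) (λ a → B (suc n) a * g a)
      ≈⟨ Σ-suc (suc n) _ ⟩
    B n 0 * g 0 + Σ (suc n) (λ a → B (suc n) (suc a) * g (suc a))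
      ≈⟨ +-congˡ (Σ-cong′ (suc n) (λ a → trans (*-congʳ (trans (ι-cong (ℤP.pos-+ (bin n a) (bin n (suc a)))) (ι-+ _ _)))
                                               (distribʳ _ _ _))) ⟩
    B n 0 * g 0 + Σ (suc n) (λ a → B n a * g (suc a) + B n (suc a) * g (suc a))
      ≈⟨ +-congˡ (trans (Σ-+ (suc n) _ _) (+-comm X Y)) ⟩
    B n 0 * g 0 + (Y + X)
      ≈⟨ sym (+-assoc _ _ _) ⟩
    (B n 0 * g 0 + Y) + X
      ≈⟨ +-congʳ (sym (Σ-suc (suc n) _)) ⟩
    Σ (suc (suc n)) (λ a → B n a * g a) + X
      ≈⟨ +-congʳ (sym (Σ-extend (suc n) (suc (suc n)) _ (ℕP.n≤1+n (suc n))
                         (λ k n<k → trans (*-congʳ (B-vanish n k n<k)) (zeroˡ _)))) ⟩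
    Σ (suc n) (λ a → B n a * g a) + X
      ≈⟨ sym (Σ-+ (suc n) _ _) ⟩
    Σ (suc n) (λ a → B n a * g a + B n a * g (suc a))
      ≈⟨ Σ-cong′ (suc n) (λ a → sym (distribˡ _ _ _)) ⟩
    Σ (suc n) (λ a → B n a * (g a + g (suc a))) ∎
    where
    X = Σ (suc n) (λ a → B n a * g (suc a))
    Y = Σ (suc n) (λ a → B n (suc a) * g (suc a))

  -- Binomial inversion.  `alternate h r = Σ_{k≤r} (-1)^{r-k} C(r,k) h(k)`;
  -- then h(n) = Σ_{a≤n} C(n,a) alternate h a, because the signed binomials
  -- are orthogonal to the binomials:
  -- orthogonality n k = Σ_{a≤n} C(n,a) (-1)^{a-k} C(a,k) = [n = k].
  alternate : (ℕ → Carrier) → ℕ → Carrier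
  alternate h r = Σ (suc r) (λ k → ι (sbin r k) * h k)

  orthogonality : ℕ → ℕ → Carrier
  orthogonality n k = Σ (suc n) (λ a → B n a * ι (sbin a k))

  orthogonality-suc : ∀ n k → orthogonality (suc n) (suc k) ≈ orthogonality n k
  orthogonality-suc n k = trans (Σ-pascal n (λ a → ι (sbin a (suc k))))
    (Σ-cong′ (suc n) (λ a → *-congˡ (trans (sym (ι-+ _ _)) (ι-cong (sbin-pascal a k)))))

  orthogonality-zero : ∀ n → orthogonality (suc n) 0 ≈ 0#
  orthogonality-zero n = begin
    orthogonality (suc n) 0
      ≈⟨ Σ-pascal n (λ a → ι (sbin a 0)) ⟩
    Σ (suc n) (λ a → B n a * (ι (sbin a 0) + ι (sbin (suc a) 0)))
      ≈⟨ Σ-cong′ (suc n) (λ a → trans (*-congˡ (trans (sym (ι-+ _ _)) (trans (ι-cong (sbin-pascal₀ a)) ι-0))) (zeroʳ _)) ⟩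
    Σ (suc n) (λ _ → 0#)
      ≈⟨ Σ-zero (suc n) ⟩
    0# ∎

  orthogonality-diagonal₀ : orthogonality 0 0 ≈ 1#
  orthogonality-diagonal₀ = begin
    orthogonality 0 0          ≈⟨ Σ-suc 0 _ ⟩
    B 0 0 * ι (+ 1) + Σ 0 _    ≈⟨ +-cong (trans (sym (ι-* (+ 1) (+ 1))) ι-1) (Σ-empty _) ⟩
    1# + 0#                    ≈⟨ +-identityʳ 1# ⟩
    1# ∎

  orthogonality-sum : ∀ n (h : ℕ → Carrier) → Σ (suc n) (λ k → orthogonality n k * h k) ≈ h n
  orthogonality-sum zero    h = begin
    Σ 1 (λ k → orthogonality 0 k * h k)   ≈⟨ Σ-suc 0 _ ⟩
    orthogonality 0 0 * h 0 + Σ 0 _       ≈⟨ +-cong (trans (*-congʳ orthogonality-diagonal₀) (*-identityˡ _)) (Σ-empty _) ⟩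
    h 0 + 0#                              ≈⟨ +-identityʳ _ ⟩
    h 0 ∎
  orthogonality-sum (suc n) h = begin
    Σ (suc (suc n)) (λ k → orthogonality (suc n) k * h k)
      ≈⟨ Σ-suc (suc n) _ ⟩
    orthogonality (suc n) 0 * h 0 + Σ (suc n) (λ k → orthogonality (suc n) (suc k) * h (suc k))
      ≈⟨ +-cong (trans (*-congʳ (orthogonality-zero n)) (zeroˡ _))
                (Σ-cong′ (suc n) (λ k → *-congʳ (orthogonality-suc n k))) ⟩
    0# + Σ (suc n) (λ k → orthogonality n k * h (suc k))
      ≈⟨ +-identityˡ _ ⟩
    Σ (suc n) (λ k → orthogonality n k * h (suc k))
      ≈⟨ orthogonality-sum n (λ k → h (suc k)) ⟩
    h (suc n) ∎

  binomial-inversion : ∀ n (h : ℕ → Carrier) → h n ≈ Σ (suc n) (λ a → B n a * alternate h a)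
  binomial-inversion n h = sym (begin
    Σ (suc n) (λ a → B n a * alternate h a)
      ≈⟨ Σ-cong (suc n) (λ a a≤n → trans (Σ-*ˡ (suc a) (B n a) _)
           (Σ-extend (suc a) (suc n) _ a≤n (λ k a<k →
              trans (*-congˡ (trans (*-congʳ (trans (ι-cong (sbin-vanish a k a<k)) ι-0)) (zeroˡ _))) (zeroʳ _)))) ⟩
    Σ (suc n) (λ a → Σ (suc n) (λ k → B n a * (ι (sbin a k) * h k)))
      ≈⟨ Σ-swap (suc n) (suc n) _ ⟩
    Σ (suc n) (λ k → Σ (suc n) (λ a → B n a * (ι (sbin a k) * h k)))
      ≈⟨ Σ-cong′ (suc n) (λ k → trans (Σ-cong′ (suc n) (λ a → sym (*-assoc _ _ _))) (sym (Σ-*ʳ (suc n) (h k) _))) ⟩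
    Σ (suc n) (λ k → orthogonality n k * h k)
      ≈⟨ orthogonality-sum n h ⟩
    h n ∎)

  module FallingFactorials (x : Carrier) where

    shifted : ℕ → Carrier
    shifted m = x + ι (ℤ.- (+ m))

    fall : ℕ → Carrier
    fall zero    = 1#
    fall (suc n) = fall n * shifted n

    fall-shift : ∀ n m → fall n * shifted m ≈ fall (suc n) + ι (+ n ℤ.- + m) * fall n
    fall-shift n m = begin
      fall n * (x + ι (ℤ.- (+ m)))
        ≈⟨ *-congˡ (+-congˡ (trans (ι-cong split) (ι-+ (ℤ.- (+ n)) (+ n ℤ.- + m)))) ⟩
      fall n * (x + (ι (ℤ.- (+ n)) + ι (+ n ℤ.- + m)))
        ≈⟨ *-congˡ (sym (+-assoc _ _ _)) ⟩
      fall n * (shifted n + ι (+ n ℤ.- + m))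
        ≈⟨ distribˡ _ _ _ ⟩
      fall (suc n) + fall n * ι (+ n ℤ.- + m)
        ≈⟨ +-congˡ (*-comm _ _) ⟩
      fall (suc n) + ι (+ n ℤ.- + m) * fall n ∎
      where
      open ℤSolver.+-*-Solver
      split : ℤ.- (+ m) ≡ ℤ.- (+ n) ℤ.+ (+ n ℤ.- + m)
      split = solve 2 (λ n m → :- m := :- n :+ (n :- m)) ≡.refl (+ n) (+ m)

    -- the k-th term of the product rule for (x)_a (x)_b, and its companion
    -- counting the matchings that use the (b+1)-st element
    term : ℕ → ℕ → ℕ → Carrier
    term a b k = ι (+ matchings a b k) * fall (b ℕ.+ a ∸ k)

    term⁺ : ℕ → ℕ → ℕ → Carrier
    term⁺ a b k = ι (+ matchings⁺ a b k) * fall (b ℕ.+ a ∸ k)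

    term-shift : ∀ a b k → k ≤ b →
      term a b k * shifted b ≈ ι (+ matchings a b k) * fall (suc b ℕ.+ a ∸ k) + term⁺ a b k
    term-shift a b k k≤b = begin
      ι (+ matchings a b k) * fall N * shifted b
        ≈⟨ *-assoc _ _ _ ⟩
      ι (+ matchings a b k) * (fall N * shifted b)
        ≈⟨ *-congˡ (fall-shift N b) ⟩
      ι (+ matchings a b k) * (fall (suc N) + ι (+ N ℤ.- + b) * fall N)
        ≈⟨ distribˡ _ _ _ ⟩
      ι (+ matchings a b k) * fall (suc N) + ι (+ matchings a b k) * (ι (+ N ℤ.- + b) * fall N)
        ≈⟨ +-cong (reflexive (≡.cong (λ u → ι (+ matchings a b k) * fall u) suc-N)) (sym (*-assoc _ _ _)) ⟩
      ι (+ matchings a b k) * fall (suc b ℕ.+ a ∸ k) + ι (+ matchings a b k) * ι (+ N ℤ.- + b) * fall N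
        ≈⟨ +-congˡ (*-congʳ (trans (sym (ι-* _ _)) (ι-cong (matchings-absorb a b k k≤b)))) ⟩
      ι (+ matchings a b k) * fall (suc b ℕ.+ a ∸ k) + term⁺ a b k ∎
      where
      N = b ℕ.+ a ∸ k
      suc-N : suc N ≡ suc b ℕ.+ a ∸ k
      suc-N = ≡.sym (ℕP.+-∸-assoc 1 (ℕP.≤-trans k≤b (ℕP.m≤m+n b a)))

    term-merge : ∀ a b k →
      ι (+ matchings a b (suc k)) * fall (b ℕ.+ a ∸ k) + term⁺ a b k ≈ term a (suc b) (suc k)
    term-merge a b k = begin
      ι (+ matchings a b (suc k)) * F + ι (+ matchings⁺ a b k) * F
        ≈⟨ sym (distribʳ _ _ _) ⟩
      (ι (+ matchings a b (suc k)) + ι (+ matchings⁺ a b k)) * F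
        ≈⟨ *-congʳ (sym (ι-+ _ _)) ⟩
      ι (+ matchings a b (suc k) ℤ.+ + matchings⁺ a b k) * F
        ≈⟨ *-congʳ (ι-cong (≡.trans (≡.sym (ℤP.pos-+ (matchings a b (suc k)) (matchings⁺ a b k)))
                                     (≡.cong +_ (≡.sym (matchings-pascal a b k))))) ⟩
      ι (+ matchings a (suc b) (suc k)) * F ∎
      where F = fall (b ℕ.+ a ∸ k)

    fall-product : ∀ a b → fall a * fall b ≈ Σ (suc b) (term a b)
    fall-product a zero = begin
      fall a * 1#               ≈⟨ *-identityʳ _ ⟩
      fall a                    ≈⟨ sym (*-identityˡ _) ⟩
      1# * fall a               ≈⟨ sym (+-identityʳ _) ⟩
      1# * fall a + 0#          ≈⟨ sym (+-cong (*-congʳ ι-1) (Σ-empty _)) ⟩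
      term a 0 0 + Σ 0 _        ≈⟨ sym (Σ-suc 0 _) ⟩
      Σ 1 (term a 0) ∎
    fall-product a (suc b) = begin
      fall a * (fall b * shifted b)
        ≈⟨ trans (sym (*-assoc _ _ _)) (*-congʳ (fall-product a b)) ⟩
      Σ (suc b) (term a b) * shifted b
        ≈⟨ trans (Σ-*ʳ (suc b) _ _) (Σ-cong (suc b) (λ k k<1+b → term-shift a b k (ℕP.≤-pred k<1+b))) ⟩
      Σ (suc b) (λ k → ι (+ matchings a b k) * fall (suc b ℕ.+ a ∸ k) + term⁺ a b k)
        ≈⟨ Σ-+ (suc b) _ _ ⟩
      Σ (suc b) (λ k → ι (+ matchings a b k) * fall (suc b ℕ.+ a ∸ k)) + V
        ≈⟨ +-congʳ (trans (Σ-extend (suc b) (suc (suc b)) _ (ℕP.n≤1+n (suc b)) vanish) (Σ-suc (suc b) _)) ⟩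
      (term a (suc b) 0 + Σ (suc b) (λ k → ι (+ matchings a b (suc k)) * fall (b ℕ.+ a ∸ k))) + V
        ≈⟨ trans (+-assoc _ _ _) (+-congˡ (sym (Σ-+ (suc b) _ _))) ⟩
      term a (suc b) 0 + Σ (suc b) (λ k → ι (+ matchings a b (suc k)) * fall (b ℕ.+ a ∸ k) + term⁺ a b k)
        ≈⟨ +-congˡ (Σ-cong′ (suc b) (term-merge a b)) ⟩
      term a (suc b) 0 + Σ (suc b) (λ k → term a (suc b) (suc k))
        ≈⟨ sym (Σ-suc (suc b) _) ⟩
      Σ (suc (suc b)) (term a (suc b)) ∎
      where
      V = Σ (suc b) (term⁺ a b)
      vanish : ∀ k → suc b ≤ k → ι (+ matchings a b k) * fall (suc b ℕ.+ a ∸ k) ≈ 0#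
      vanish k b<k = trans (*-congʳ (trans (ι-cong (≡.cong +_ (matchings-vanish a b k b<k))) ι-0)) (zeroˡ _)

  module ProductRule (i : ℕ) (x : Carrier) where
    open FallingFactorials x

    P̄ : ℕ → Carrier
    P̄ n = ι (+ (i ^ n)) * fall n

    P : ℕ → Carrier
    P = alternate P̄

    ι-*-assoc : ∀ m n F → ι (+ m) * (ι (+ n) * F) ≈ ι (+ (m ℕ.* n)) * F
    ι-*-assoc m n F = trans (sym (*-assoc _ _ _)) (*-congʳ (trans (sym (ι-* (+ m) (+ n))) (ι-cong (≡.sym (ℤP.pos-* m n)))))

    ^-split : ∀ l d k → k ≤ l → i ^ l ℕ.* i ^ d ≡ i ^ k ℕ.* i ^ (l ℕ.+ d ∸ k)
    ^-split l d k k≤l = ≡.trans (≡.sym (ℕP.^-distribˡ-+-* i l d))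
      (≡.trans (≡.cong (i ^_) (≡.sym (ℕP.m+[n∸m]≡n (ℕP.≤-trans k≤l (ℕP.m≤m+n l d)))))
               (ℕP.^-distribˡ-+-* i k (l ℕ.+ d ∸ k)))

    P̄-product : ∀ l d → P̄ l * P̄ d ≈ Σ (suc l) (λ k → ι (+ (matchings d l k ℕ.* i ^ k)) * P̄ (l ℕ.+ d ∸ k))
    P̄-product l d = begin
      ι (+ (i ^ l)) * fall l * (ι (+ (i ^ d)) * fall d)
        ≈⟨ trans (*-assoc _ _ _) (*-congˡ (trans (*-comm _ _) (*-assoc _ _ _))) ⟩
      ι (+ (i ^ l)) * (ι (+ (i ^ d)) * (fall d * fall l))
        ≈⟨ ι-*-assoc _ _ _ ⟩
      ι (+ (i ^ l ℕ.* i ^ d)) * (fall d * fall l)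
        ≈⟨ *-congˡ (fall-product d l) ⟩
      ι (+ (i ^ l ℕ.* i ^ d)) * Σ (suc l) (term d l)
        ≈⟨ Σ-*ˡ (suc l) _ _ ⟩
      Σ (suc l) (λ k → ι (+ (i ^ l ℕ.* i ^ d)) * term d l k)
        ≈⟨ Σ-cong (suc l) (λ k k<1+l → trans (ι-*-assoc _ _ _) (trans (*-congʳ (ι-cong (≡.cong +_ (regroup k (ℕP.≤-pred k<1+l)))))
                                                                     (sym (ι-*-assoc _ _ _)))) ⟩
      Σ (suc l) (λ k → ι (+ (matchings d l k ℕ.* i ^ k)) * P̄ (l ℕ.+ d ∸ k)) ∎
      where
      regroup : ∀ k → k ≤ l → i ^ l ℕ.* i ^ d ℕ.* matchings d l k ≡ matchings d l k ℕ.* i ^ k ℕ.* i ^ (l ℕ.+ d ∸ k)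
      regroup k k≤l = ≡.trans (≡.cong (ℕ._* matchings d l k) (^-split l d k k≤l))
                              (rotate (matchings d l k) (i ^ k) (i ^ (l ℕ.+ d ∸ k)))
        where
        rotate : ∀ c u v → u ℕ.* v ℕ.* c ≡ c ℕ.* u ℕ.* v
        rotate = solve-∀

    P̄-in-P : ∀ N M → N < M → P̄ N ≈ Σ M (λ a → B N a * P a)
    P̄-in-P N M N<M = trans (binomial-inversion N P̄)
      (Σ-extend (suc N) M _ N<M (λ a N<a → trans (*-congʳ (B-vanish N a N<a)) (zeroˡ _)))

    weight : ℕ → ℕ → ℕ → ℕ → ℕ → ℕ → ℤ
    weight r s l d k a = sbin r l ℤ.* sbin s d ℤ.* + (matchings d l k ℕ.* i ^ k) ℤ.* + bin (l ℕ.+ d ∸ k) a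

    coefficient : ℕ → ℕ → ℕ → Carrier
    coefficient r s a = Σ (suc r) (λ l → Σ (suc s) (λ d → Σ (suc l) (λ k → ι (weight r s l d k a))))

    P-bilinear : ∀ r s → P r * P s ≈ Σ (suc r) (λ l → Σ (suc s) (λ d → ι (sbin r l ℤ.* sbin s d) * (P̄ l * P̄ d)))
    P-bilinear r s = begin
      Σ (suc r) (λ l → ι (sbin r l) * P̄ l) * Σ (suc s) (λ d → ι (sbin s d) * P̄ d)
        ≈⟨ Σ-*ʳ (suc r) _ _ ⟩
      Σ (suc r) (λ l → ι (sbin r l) * P̄ l * Σ (suc s) (λ d → ι (sbin s d) * P̄ d))
        ≈⟨ Σ-cong′ (suc r) (λ l → trans (Σ-*ˡ (suc s) _ _) (Σ-cong′ (suc s) (λ d → regroup _ _ _ _))) ⟩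
      Σ (suc r) (λ l → Σ (suc s) (λ d → ι (sbin r l ℤ.* sbin s d) * (P̄ l * P̄ d))) ∎
      where
      regroup : ∀ a b F G → ι a * F * (ι b * G) ≈ ι (a ℤ.* b) * (F * G)
      regroup a b F G = begin
        ι a * F * (ι b * G)     ≈⟨ *-assoc _ _ _ ⟩
        ι a * (F * (ι b * G))   ≈⟨ *-congˡ (x∙yz≈y∙xz F (ι b) G) ⟩
        ι a * (ι b * (F * G))   ≈⟨ sym (*-assoc _ _ _) ⟩
        ι a * ι b * (F * G)     ≈⟨ *-congʳ (sym (ι-* a b)) ⟩
        ι (a ℤ.* b) * (F * G)   ∎
        where open import Algebra.Properties.CommutativeSemigroup *-commutativeSemigroup using (x∙yz≈y∙xz)

    term-in-P : ∀ r s l d → l ≤ r → d ≤ s →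
      ι (sbin r l ℤ.* sbin s d) * (P̄ l * P̄ d)
        ≈ Σ (suc l) (λ k → Σ (suc (r ℕ.+ s)) (λ a → ι (weight r s l d k a) * P a))
    term-in-P r s l d l≤r d≤s = begin
      ι σ * (P̄ l * P̄ d)
        ≈⟨ trans (*-congˡ (P̄-product l d)) (Σ-*ˡ (suc l) _ _) ⟩
      Σ (suc l) (λ k → ι σ * (ι (+ (matchings d l k ℕ.* i ^ k)) * P̄ (l ℕ.+ d ∸ k)))
        ≈⟨ Σ-cong′ (suc l) (λ k → trans (sym (*-assoc _ _ _)) (*-congʳ (sym (ι-* _ _)))) ⟩
      Σ (suc l) (λ k → ι (σ ℤ.* + (matchings d l k ℕ.* i ^ k)) * P̄ (l ℕ.+ d ∸ k))
        ≈⟨ Σ-cong′ (suc l) (λ k → *-congˡ (P̄-in-P (l ℕ.+ d ∸ k) M (s≤s (bound k)))) ⟩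
      Σ (suc l) (λ k → ι (σ ℤ.* + (matchings d l k ℕ.* i ^ k)) * Σ M (λ a → B (l ℕ.+ d ∸ k) a * P a))
        ≈⟨ Σ-cong′ (suc l) (λ k → trans (Σ-*ˡ M _ _) (Σ-cong′ M (λ a → trans (sym (*-assoc _ _ _)) (*-congʳ (sym (ι-* _ _)))))) ⟩
      Σ (suc l) (λ k → Σ M (λ a → ι (weight r s l d k a) * P a)) ∎
      where
      σ = sbin r l ℤ.* sbin s d
      M = suc (r ℕ.+ s)
      bound : ∀ k → l ℕ.+ d ∸ k ≤ r ℕ.+ s
      bound k = ℕP.≤-trans (ℕP.m∸n≤m (l ℕ.+ d) k) (ℕP.+-mono-≤ l≤r d≤s)

    P-product : ∀ r s → P r * P s ≈ Σ (suc (r ℕ.+ s)) (λ a → coefficient r s a * P a)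
    P-product r s = begin
      P r * P s
        ≈⟨ P-bilinear r s ⟩
      Σ (suc r) (λ l → Σ (suc s) (λ d → ι (sbin r l ℤ.* sbin s d) * (P̄ l * P̄ d)))
        ≈⟨ Σ-cong (suc r) (λ l l<r → Σ-cong (suc s) (λ d d<s → term-in-P r s l d (ℕP.≤-pred l<r) (ℕP.≤-pred d<s))) ⟩
      Σ (suc r) (λ l → Σ (suc s) (λ d → Σ (suc l) (λ k → Σ M (λ a → ι (weight r s l d k a) * P a))))
        ≈⟨ Σ-cong′ (suc r) (λ l → trans (Σ-cong′ (suc s) (λ d → Σ-swap (suc l) M _)) (Σ-swap (suc s) M _)) ⟩
      Σ (suc r) (λ l → Σ M (λ a → Σ (suc s) (λ d → Σ (suc l) (λ k → ι (weight r s l d k a) * P a))))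
        ≈⟨ Σ-swap (suc r) M _ ⟩
      Σ M (λ a → Σ (suc r) (λ l → Σ (suc s) (λ d → Σ (suc l) (λ k → ι (weight r s l d k a) * P a))))
        ≈⟨ Σ-cong′ M (λ a → sym (trans (Σ-*ʳ (suc r) _ _) (Σ-cong′ (suc r) (λ l →
             trans (Σ-*ʳ (suc s) _ _) (Σ-cong′ (suc s) (λ d → Σ-*ʳ (suc l) _ _)))))) ⟩
      Σ M (λ a → coefficient r s a * P a) ∎
      where M = suc (r ℕ.+ s)

open Defs

-- Monomials are exponent vectors; `k ≼ᵇ m` decides whether the monomial k
-- divides m, and `m ∸ₘ k` is the quotient.  Their defining property
-- (`eqMono-addMono`) lets us solve `k · n = m` for n.
-- (`_≤ᵇ'_` is the library's `_≤ᵇ_`, defined by structural recursion so that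
-- it unfolds on successors.)

_≤ᵇ'_ : ℕ → ℕ → Bool
zero  ≤ᵇ' _     = true
suc _ ≤ᵇ' zero  = false
suc a ≤ᵇ' suc b = a ≤ᵇ' b

_≼ᵇ_ : Mono → Mono → Bool
[]       ≼ᵇ m        = true
(x ∷ xs) ≼ᵇ []       = (x ≡ᵇ 0) ∧ (xs ≼ᵇ [])
(x ∷ xs) ≼ᵇ (y ∷ ys) = (x ≤ᵇ' y) ∧ (xs ≼ᵇ ys)

_∸ₘ_ : Mono → Mono → Mono
m        ∸ₘ []       = m
[]       ∸ₘ (_ ∷ _)  = []
(y ∷ ys) ∸ₘ (x ∷ xs) = (y ∸ x) ∷ (ys ∸ₘ xs)

module MonomialArithmetic where
  open ≡ using (refl; sym; trans; cong; cong₂)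
  open ≡-Reasoning

  eqMono-[] : ∀ xs → eqMono xs [] ≡ (xs ≼ᵇ [])
  eqMono-[] []       = refl
  eqMono-[] (x ∷ xs) = cong ((x ≡ᵇ 0) ∧_) (eqMono-[] xs)

  addMono-identityʳ : ∀ xs → addMono xs [] ≡ xs
  addMono-identityʳ []       = refl
  addMono-identityʳ (x ∷ xs) = refl

  []∸ₘ : ∀ xs → [] ∸ₘ xs ≡ []
  []∸ₘ []       = refl
  []∸ₘ (x ∷ xs) = refl

  -- The one-variable instances of `eqMono-addMono`.
  ≡ᵇ-via-∸ : ∀ x y → (x ≡ᵇ y) ≡ (x ≤ᵇ' y) ∧ ((y ∸ x) ≡ᵇ 0)
  ≡ᵇ-via-∸ zero    zero    = refl
  ≡ᵇ-via-∸ zero    (suc y) = refl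
  ≡ᵇ-via-∸ (suc x) zero    = refl
  ≡ᵇ-via-∸ (suc x) (suc y) = ≡ᵇ-via-∸ x y

  +≡ᵇ : ∀ x z y → (x ℕ.+ z ≡ᵇ y) ≡ (x ≤ᵇ' y) ∧ (z ≡ᵇ y ∸ x)
  +≡ᵇ zero    z y       = refl
  +≡ᵇ (suc x) z zero    = refl
  +≡ᵇ (suc x) z (suc y) = +≡ᵇ x z y

  +≡ᵇ0 : ∀ x z → (x ℕ.+ z ≡ᵇ 0) ≡ (x ≡ᵇ 0) ∧ (z ≡ᵇ 0)
  +≡ᵇ0 zero    z = refl
  +≡ᵇ0 (suc x) z = refl

  ∧-interchange : ∀ a b c d → (a ∧ b) ∧ (c ∧ d) ≡ (a ∧ c) ∧ (b ∧ d)
  ∧-interchange true  true  c d = refl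
  ∧-interchange true  false c d = sym (∧-zeroʳ c)
  ∧-interchange false b     c d = refl

  eqMono-addMono : ∀ k n m → eqMono (addMono k n) m ≡ (k ≼ᵇ m) ∧ eqMono n (m ∸ₘ k)
  eqMono-addMono []       n        m        = refl
  eqMono-addMono (x ∷ xs) []       []       = begin
    (x ≡ᵇ 0) ∧ eqMono xs []        ≡⟨ cong ((x ≡ᵇ 0) ∧_) (eqMono-[] xs) ⟩
    (x ≡ᵇ 0) ∧ (xs ≼ᵇ [])          ≡⟨ sym (∧-identityʳ _) ⟩
    ((x ≡ᵇ 0) ∧ (xs ≼ᵇ [])) ∧ true ∎
  eqMono-addMono (x ∷ xs) []       (y ∷ ys) = begin
    (x ≡ᵇ y) ∧ eqMono xs ys
      ≡⟨ cong₂ _∧_ (≡ᵇ-via-∸ x y)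
           (trans (cong (λ u → eqMono u ys) (sym (addMono-identityʳ xs))) (eqMono-addMono xs [] ys)) ⟩
    ((x ≤ᵇ' y) ∧ ((y ∸ x) ≡ᵇ 0)) ∧ ((xs ≼ᵇ ys) ∧ eqMono [] (ys ∸ₘ xs))
      ≡⟨ ∧-interchange (x ≤ᵇ' y) _ (xs ≼ᵇ ys) _ ⟩
    ((x ≤ᵇ' y) ∧ (xs ≼ᵇ ys)) ∧ (((y ∸ x) ≡ᵇ 0) ∧ eqMono [] (ys ∸ₘ xs)) ∎
  eqMono-addMono (x ∷ xs) (z ∷ zs) []       = begin
    (x ℕ.+ z ≡ᵇ 0) ∧ eqMono (addMono xs zs) []
      ≡⟨ cong₂ _∧_ (+≡ᵇ0 x z)
           (trans (eqMono-addMono xs zs []) (cong (λ u → (xs ≼ᵇ []) ∧ eqMono zs u) ([]∸ₘ xs))) ⟩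
    ((x ≡ᵇ 0) ∧ (z ≡ᵇ 0)) ∧ ((xs ≼ᵇ []) ∧ eqMono zs [])
      ≡⟨ ∧-interchange (x ≡ᵇ 0) (z ≡ᵇ 0) (xs ≼ᵇ []) _ ⟩
    ((x ≡ᵇ 0) ∧ (xs ≼ᵇ [])) ∧ ((z ≡ᵇ 0) ∧ eqMono zs []) ∎
  eqMono-addMono (x ∷ xs) (z ∷ zs) (y ∷ ys) = begin
    (x ℕ.+ z ≡ᵇ y) ∧ eqMono (addMono xs zs) ys
      ≡⟨ cong₂ _∧_ (+≡ᵇ x z y) (eqMono-addMono xs zs ys) ⟩
    ((x ≤ᵇ' y) ∧ (z ≡ᵇ y ∸ x)) ∧ ((xs ≼ᵇ ys) ∧ eqMono zs (ys ∸ₘ xs))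
      ≡⟨ ∧-interchange (x ≤ᵇ' y) _ (xs ≼ᵇ ys) _ ⟩
    ((x ≤ᵇ' y) ∧ (xs ≼ᵇ ys)) ∧ ((z ≡ᵇ y ∸ x) ∧ eqMono zs (ys ∸ₘ xs)) ∎

  addMono-comm : ∀ a b → addMono a b ≡ addMono b a
  addMono-comm []      []      = refl
  addMono-comm []      (_ ∷ _) = refl
  addMono-comm (_ ∷ _) []      = refl
  addMono-comm (x ∷ a) (y ∷ b) = cong₂ _∷_ (ℕP.+-comm x y) (addMono-comm a b)

  addMono-assoc : ∀ a b c → addMono (addMono a b) c ≡ addMono a (addMono b c)
  addMono-assoc []      b       c       = refl
  addMono-assoc (_ ∷ _) []      c       = refl
  addMono-assoc (_ ∷ _) (_ ∷ _) []      = refl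
  addMono-assoc (x ∷ a) (y ∷ b) (z ∷ c) = cong₂ _∷_ (ℕP.+-assoc x y z) (addMono-assoc a b c)

-- The embedding ℤ → ℚ of Defs is a ring homomorphism.  We compare it with
-- the fraction z/1 built directly by `mkℚ`, on which ℚ's operations compute.
module IntegerEmbedding where
  open ≡ using (refl; sym; trans; cong; cong₂)

  private
    embed : ℤ → ℚ
    embed z = mkℚ z 0 (Coprime.sym (Coprime.1-coprimeTo ℤ.∣ z ∣))

    ℤ→ℚ≡embed : ∀ z → ℤ→ℚ z ≡ embed z
    ℤ→ℚ≡embed (+ n)    = ℚP.normalize-coprime {n} {0} (Coprime.sym (Coprime.1-coprimeTo n))
    ℤ→ℚ≡embed -[1+ n ] = cong ℚ.-_ (ℚP.normalize-coprime {suc n} {0} (Coprime.sym (Coprime.1-coprimeTo (suc n))))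

  ℤ→ℚ-+ : ∀ a b → ℤ→ℚ (a ℤ.+ b) ≡ ℤ→ℚ a ℚ.+ ℤ→ℚ b
  ℤ→ℚ-+ a b rewrite ℤ→ℚ≡embed a | ℤ→ℚ≡embed b =
    trans (cong₂ (λ u v → ℤ→ℚ (u ℤ.+ v)) (sym (ℤP.*-identityʳ a)) (sym (ℤP.*-identityʳ b))) refl

  ℤ→ℚ-* : ∀ a b → ℤ→ℚ (a ℤ.* b) ≡ ℤ→ℚ a ℚ.* ℤ→ℚ b
  ℤ→ℚ-* a b rewrite ℤ→ℚ≡embed a | ℤ→ℚ≡embed b = refl

-- Coefficients are the weighings of
-- indicator functions, and weighing turns ⊕, · and ⊗ into +, scaling and an
-- iterated weighing; every ring law of Sym is read off from these rules.
module Weighing where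
  open ≡ using (refl; sym; trans; cong; cong₂)
  open ℚSolver.+-*-Solver
  open ≡-Reasoning

  weigh : Sym → (Mono → ℚ) → ℚ
  weigh []            φ = 0ℚ
  weigh ((a , m) ∷ f) φ = a ℚ.* φ m ℚ.+ weigh f φ

  χ : Bool → ℚ
  χ true  = 1ℚ
  χ false = 0ℚ

  χ-∧ : ∀ a b → χ (a ∧ b) ≡ χ a ℚ.* χ b
  χ-∧ true  b = sym (ℚP.*-identityˡ (χ b))
  χ-∧ false b = sym (ℚP.*-zeroˡ (χ b))

  δ : Mono → Mono → ℚ
  δ m n = χ (eqMono n m)

  coeff-weigh : ∀ f m → coeff f m ≡ weigh f (δ m)
  coeff-weigh []             m = refl
  coeff-weigh ((a , m') ∷ f) m = cong₂ ℚ._+_ (if-χ (eqMono m' m)) (coeff-weigh f m)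
    where
    if-χ : ∀ b → (if b then a else 0ℚ) ≡ a ℚ.* χ b
    if-χ true  = sym (ℚP.*-identityʳ a)
    if-χ false = sym (ℚP.*-zeroʳ a)

  weigh-cong : ∀ f {φ ψ} → (∀ m → φ m ≡ ψ m) → weigh f φ ≡ weigh f ψ
  weigh-cong []            e = refl
  weigh-cong ((a , m) ∷ f) e = cong₂ (λ u v → a ℚ.* u ℚ.+ v) (e m) (weigh-cong f e)

  weigh-zero : ∀ f → weigh f (λ _ → 0ℚ) ≡ 0ℚ
  weigh-zero []            = refl
  weigh-zero ((a , m) ∷ f) = cong₂ ℚ._+_ (ℚP.*-zeroʳ a) (weigh-zero f)

  weigh-scale : ∀ f c φ → weigh f (λ m → c ℚ.* φ m) ≡ c ℚ.* weigh f φ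
  weigh-scale []            c φ = sym (ℚP.*-zeroʳ c)
  weigh-scale ((a , m) ∷ f) c φ = trans (cong (a ℚ.* (c ℚ.* φ m) ℚ.+_) (weigh-scale f c φ))
    (solve 4 (λ a c x t → a :* (c :* x) :+ c :* t := c :* (a :* x :+ t)) refl a c (φ m) (weigh f φ))

  weigh-+ : ∀ f φ ψ → weigh f (λ m → φ m ℚ.+ ψ m) ≡ weigh f φ ℚ.+ weigh f ψ
  weigh-+ []            φ ψ = refl
  weigh-+ ((a , m) ∷ f) φ ψ = trans (cong (a ℚ.* (φ m ℚ.+ ψ m) ℚ.+_) (weigh-+ f φ ψ))
    (solve 5 (λ a x y t u → a :* (x :+ y) :+ (t :+ u) := (a :* x :+ t) :+ (a :* y :+ u))
       refl a (φ m) (ψ m) (weigh f φ) (weigh f ψ))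

  weigh-⊕ : ∀ f g φ → weigh (f ⊕ g) φ ≡ weigh f φ ℚ.+ weigh g φ
  weigh-⊕ []            g φ = sym (ℚP.+-identityˡ (weigh g φ))
  weigh-⊕ ((a , m) ∷ f) g φ = trans (cong (a ℚ.* φ m ℚ.+_) (weigh-⊕ f g φ))
    (sym (ℚP.+-assoc (a ℚ.* φ m) (weigh f φ) (weigh g φ)))

  weigh-· : ∀ c f φ → weigh (c · f) φ ≡ c ℚ.* weigh f φ
  weigh-· c []            φ = sym (ℚP.*-zeroʳ c)
  weigh-· c ((a , m) ∷ f) φ = trans (cong (c ℚ.* a ℚ.* φ m ℚ.+_) (weigh-· c f φ))
    (solve 4 (λ c a x t → c :* a :* x :+ c :* t := c :* (a :* x :+ t)) refl c a (φ m) (weigh f φ))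

  weigh-⊗ : ∀ f g φ → weigh (f ⊗ g) φ ≡ weigh f (λ k → weigh g (λ n → φ (addMono k n)))
  weigh-⊗ []            g φ = refl
  weigh-⊗ ((a , m) ∷ f) g φ =
    trans (weigh-⊕ (map (λ { (b , n) → (a ℚ.* b , addMono m n) }) g) (f ⊗ g) φ)
          (cong₂ ℚ._+_ (weigh-row g) (weigh-⊗ f g φ))
    where
    weigh-row : ∀ g → weigh (map (λ { (b , n) → (a ℚ.* b , addMono m n) }) g) φ
                      ≡ a ℚ.* weigh g (λ n → φ (addMono m n))
    weigh-row []            = sym (ℚP.*-zeroʳ a)
    weigh-row ((b , n) ∷ g) = trans (cong (a ℚ.* b ℚ.* φ (addMono m n) ℚ.+_) (weigh-row g))
      (solve 4 (λ a b x t → a :* b :* x :+ a :* t := a :* (b :* x :+ t))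
         refl a b (φ (addMono m n)) (weigh g (λ n → φ (addMono m n))))

  weigh-swap : ∀ f g (ψ : Mono → Mono → ℚ) →
    weigh f (λ k → weigh g (ψ k)) ≡ weigh g (λ n → weigh f (λ k → ψ k n))
  weigh-swap []            g ψ = sym (weigh-zero g)
  weigh-swap ((a , m) ∷ f) g ψ = begin
    a ℚ.* weigh g (ψ m) ℚ.+ weigh f (λ k → weigh g (ψ k))
      ≡⟨ cong₂ ℚ._+_ (sym (weigh-scale g a (ψ m))) (weigh-swap f g ψ) ⟩
    weigh g (λ n → a ℚ.* ψ m n) ℚ.+ weigh g (λ n → weigh f (λ k → ψ k n))
      ≡⟨ sym (weigh-+ g _ _) ⟩
    weigh g (λ n → a ℚ.* ψ m n ℚ.+ weigh f (λ k → ψ k n)) ∎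

module SymIsRing where
  open Weighing
  open MonomialArithmetic using (eqMono-addMono; addMono-comm; addMono-assoc)
  open ≡ using (refl; sym; trans; cong; cong₂)
  open ℚSolver.+-*-Solver using (solve; _:+_; _:*_; :-_; con; _:=_)
  open ≡-Reasoning

  ≈-by-weigh : ∀ f g → (∀ m → weigh f (δ m) ≡ weigh g (δ m)) → f ≈ g
  ≈-by-weigh f g e m = trans (coeff-weigh f m) (trans (e m) (sym (coeff-weigh g m)))

  coeff-⊕ : ∀ f g m → coeff (f ⊕ g) m ≡ coeff f m ℚ.+ coeff g m
  coeff-⊕ f g m = trans (coeff-weigh (f ⊕ g) m)
    (trans (weigh-⊕ f g (δ m)) (sym (cong₂ ℚ._+_ (coeff-weigh f m) (coeff-weigh g m))))

  coeff-· : ∀ c f m → coeff (c · f) m ≡ c ℚ.* coeff f m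
  coeff-· c f m = trans (coeff-weigh (c · f) m)
    (trans (weigh-· c f (δ m)) (cong (c ℚ.*_) (sym (coeff-weigh f m))))

  coeff-⊗ : ∀ f g m → coeff (f ⊗ g) m ≡ weigh f (λ k → χ (k ≼ᵇ m) ℚ.* coeff g (m ∸ₘ k))
  coeff-⊗ f g m = trans (coeff-weigh (f ⊗ g) m) (trans (weigh-⊗ f g (δ m)) (weigh-cong f λ k →
    begin
      weigh g (λ n → χ (eqMono (addMono k n) m))
        ≡⟨ weigh-cong g (λ n → trans (cong χ (eqMono-addMono k n m)) (χ-∧ (k ≼ᵇ m) _)) ⟩
      weigh g (λ n → χ (k ≼ᵇ m) ℚ.* δ (m ∸ₘ k) n)
        ≡⟨ weigh-scale g (χ (k ≼ᵇ m)) (δ (m ∸ₘ k)) ⟩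
      χ (k ≼ᵇ m) ℚ.* weigh g (δ (m ∸ₘ k))
        ≡⟨ cong (χ (k ≼ᵇ m) ℚ.*_) (sym (coeff-weigh g (m ∸ₘ k))) ⟩
      χ (k ≼ᵇ m) ℚ.* coeff g (m ∸ₘ k) ∎))

  neg : Sym → Sym
  neg f = (ℚ.- 1ℚ) · f

  ≈-refl : ∀ {f} → f ≈ f
  ≈-refl m = refl

  ≈-sym : ∀ {f g} → f ≈ g → g ≈ f
  ≈-sym e m = sym (e m)

  ≈-trans : ∀ {f g h} → f ≈ g → g ≈ h → f ≈ h
  ≈-trans e e' m = trans (e m) (e' m)

  ⊕-cong : ∀ {f f' g g'} → f ≈ f' → g ≈ g' → f ⊕ g ≈ f' ⊕ g'
  ⊕-cong {f} {f'} {g} {g'} e e' m =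
    trans (coeff-⊕ f g m) (trans (cong₂ ℚ._+_ (e m) (e' m)) (sym (coeff-⊕ f' g' m)))

  ⊕-assoc : ∀ f g h → (f ⊕ g) ⊕ h ≈ f ⊕ (g ⊕ h)
  ⊕-assoc f g h m = cong (λ u → coeff u m) (++-assoc f g h)

  ⊕-comm : ∀ f g → f ⊕ g ≈ g ⊕ f
  ⊕-comm f g m = trans (coeff-⊕ f g m)
    (trans (ℚP.+-comm (coeff f m) (coeff g m)) (sym (coeff-⊕ g f m)))

  ⊕-identityʳ : ∀ f → f ⊕ [] ≈ f
  ⊕-identityʳ f m = trans (coeff-⊕ f [] m) (ℚP.+-identityʳ (coeff f m))

  neg-cong : ∀ {f g} → f ≈ g → neg f ≈ neg g
  neg-cong {f} {g} e m =
    trans (coeff-· (ℚ.- 1ℚ) f m) (trans (cong ((ℚ.- 1ℚ) ℚ.*_) (e m)) (sym (coeff-· (ℚ.- 1ℚ) g m)))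

  neg-inverseʳ : ∀ f → f ⊕ neg f ≈ []
  neg-inverseʳ f m = trans (coeff-⊕ f (neg f) m) (trans (cong (coeff f m ℚ.+_) (coeff-· (ℚ.- 1ℚ) f m))
    (solve 1 (λ x → x :+ (:- con 1ℚ) :* x := con 0ℚ) refl (coeff f m)))

  neg-inverseˡ : ∀ f → neg f ⊕ f ≈ []
  neg-inverseˡ f = ≈-trans {neg f ⊕ f} {f ⊕ neg f} {[]} (⊕-comm (neg f) f) (neg-inverseʳ f)

  ⊗-congʳ : ∀ f {g g'} → g ≈ g' → f ⊗ g ≈ f ⊗ g'
  ⊗-congʳ f {g} {g'} e m = trans (coeff-⊗ f g m)
    (trans (weigh-cong f (λ k → cong (χ (k ≼ᵇ m) ℚ.*_) (e (m ∸ₘ k)))) (sym (coeff-⊗ f g' m)))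

  ⊗-comm : ∀ f g → f ⊗ g ≈ g ⊗ f
  ⊗-comm f g = ≈-by-weigh (f ⊗ g) (g ⊗ f) λ m → begin
    weigh (f ⊗ g) (δ m)
      ≡⟨ weigh-⊗ f g (δ m) ⟩
    weigh f (λ k → weigh g (λ n → δ m (addMono k n)))
      ≡⟨ weigh-swap f g (λ k n → δ m (addMono k n)) ⟩
    weigh g (λ n → weigh f (λ k → δ m (addMono k n)))
      ≡⟨ weigh-cong g (λ n → weigh-cong f (λ k → cong (δ m) (addMono-comm k n))) ⟩
    weigh g (λ n → weigh f (λ k → δ m (addMono n k)))
      ≡⟨ sym (weigh-⊗ g f (δ m)) ⟩
    weigh (g ⊗ f) (δ m) ∎

  ⊗-congˡ : ∀ {f f'} g → f ≈ f' → f ⊗ g ≈ f' ⊗ g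
  ⊗-congˡ {f} {f'} g e =
    ≈-trans {f ⊗ g} {g ⊗ f} {f' ⊗ g} (⊗-comm f g)
      (≈-trans {g ⊗ f} {g ⊗ f'} {f' ⊗ g} (⊗-congʳ g {f} {f'} e) (⊗-comm g f'))

  ⊗-cong : ∀ {f f' g g'} → f ≈ f' → g ≈ g' → f ⊗ g ≈ f' ⊗ g'
  ⊗-cong {f} {f'} {g} {g'} e e' =
    ≈-trans {f ⊗ g} {f' ⊗ g} {f' ⊗ g'} (⊗-congˡ {f} {f'} g e) (⊗-congʳ f' {g} {g'} e')

  ⊗-assoc : ∀ f g h → (f ⊗ g) ⊗ h ≈ f ⊗ (g ⊗ h)
  ⊗-assoc f g h = ≈-by-weigh ((f ⊗ g) ⊗ h) (f ⊗ (g ⊗ h)) λ m → begin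
    weigh ((f ⊗ g) ⊗ h) (δ m)
      ≡⟨ weigh-⊗ (f ⊗ g) h (δ m) ⟩
    weigh (f ⊗ g) (λ k → weigh h (λ n → δ m (addMono k n)))
      ≡⟨ weigh-⊗ f g _ ⟩
    weigh f (λ a → weigh g (λ b → weigh h (λ c → δ m (addMono (addMono a b) c))))
      ≡⟨ weigh-cong f (λ a → weigh-cong g (λ b → weigh-cong h (λ c → cong (δ m) (addMono-assoc a b c)))) ⟩
    weigh f (λ a → weigh g (λ b → weigh h (λ c → δ m (addMono a (addMono b c)))))
      ≡⟨ weigh-cong f (λ a → sym (weigh-⊗ g h (λ n → δ m (addMono a n)))) ⟩
    weigh f (λ a → weigh (g ⊗ h) (λ n → δ m (addMono a n)))
      ≡⟨ sym (weigh-⊗ f (g ⊗ h) (δ m)) ⟩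
    weigh (f ⊗ (g ⊗ h)) (δ m) ∎

  one-⊗ : ∀ f → one ⊗ f ≈ f
  one-⊗ f = ≈-by-weigh (one ⊗ f) f λ m → begin
    weigh (one ⊗ f) (δ m)          ≡⟨ weigh-⊗ one f (δ m) ⟩
    1ℚ ℚ.* weigh f (δ m) ℚ.+ 0ℚ    ≡⟨ ℚP.+-identityʳ _ ⟩
    1ℚ ℚ.* weigh f (δ m)           ≡⟨ ℚP.*-identityˡ _ ⟩
    weigh f (δ m)                  ∎

  ⊗-distribˡ : ∀ f g h → f ⊗ (g ⊕ h) ≈ f ⊗ g ⊕ f ⊗ h
  ⊗-distribˡ f g h = ≈-by-weigh (f ⊗ (g ⊕ h)) (f ⊗ g ⊕ f ⊗ h) λ m → begin
    weigh (f ⊗ (g ⊕ h)) (δ m)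
      ≡⟨ weigh-⊗ f (g ⊕ h) (δ m) ⟩
    weigh f (λ k → weigh (g ⊕ h) (λ n → δ m (addMono k n)))
      ≡⟨ weigh-cong f (λ k → weigh-⊕ g h (λ n → δ m (addMono k n))) ⟩
    weigh f (λ k → weigh g (λ n → δ m (addMono k n)) ℚ.+ weigh h (λ n → δ m (addMono k n)))
      ≡⟨ weigh-+ f _ _ ⟩
    weigh f (λ k → weigh g (λ n → δ m (addMono k n))) ℚ.+ weigh f (λ k → weigh h (λ n → δ m (addMono k n)))
      ≡⟨ sym (cong₂ ℚ._+_ (weigh-⊗ f g (δ m)) (weigh-⊗ f h (δ m))) ⟩
    weigh (f ⊗ g) (δ m) ℚ.+ weigh (f ⊗ h) (δ m)
      ≡⟨ sym (weigh-⊕ (f ⊗ g) (f ⊗ h) (δ m)) ⟩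
    weigh (f ⊗ g ⊕ f ⊗ h) (δ m) ∎

  ⊗-identityʳ : ∀ f → f ⊗ one ≈ f
  ⊗-identityʳ f = ≈-trans {f ⊗ one} {one ⊗ f} {f} (⊗-comm f one) (one-⊗ f)

  ⊗-distribʳ : ∀ f g h → (g ⊕ h) ⊗ f ≈ g ⊗ f ⊕ h ⊗ f
  ⊗-distribʳ f g h =
    ≈-trans {(g ⊕ h) ⊗ f} {f ⊗ (g ⊕ h)} {g ⊗ f ⊕ h ⊗ f} (⊗-comm (g ⊕ h) f)
      (≈-trans {f ⊗ (g ⊕ h)} {f ⊗ g ⊕ f ⊗ h} {g ⊗ f ⊕ h ⊗ f} (⊗-distribˡ f g h)
        (⊕-cong {f ⊗ g} {g ⊗ f} {f ⊗ h} {h ⊗ f} (⊗-comm f g) (⊗-comm f h)))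

  -- `_≈_` unfolds to a Π-type, from which Agda cannot recover the two
  -- polynomials; wrapping it in a record makes the ring's equality inferable.
  infix 4 _≋_
  record _≋_ (f g : Sym) : Set where
    constructor wrap
    field unwrap : f ≈ g
  open _≋_ public

  SymRing : CommutativeRing 0ℓ 0ℓ
  SymRing = record
    { Carrier = Sym ; _≈_ = _≋_ ; _+_ = _⊕_ ; _*_ = _⊗_ ; -_ = neg ; 0# = [] ; 1# = one
    ; isCommutativeRing = record
      { isRing = record
        { +-isAbelianGroup = record
          { isGroup = record
            { isMonoid = record
              { isSemigroup = record
                { isMagma = record
                  { isEquivalence = record
                    { refl  = λ {f} → wrap (≈-refl {f})
                    ; sym   = λ {f} {g} e → wrap (≈-sym {f} {g} (unwrap e))
                    ; trans = λ {f} {g} {h} e e' → wrap (≈-trans {f} {g} {h} (unwrap e) (unwrap e')) }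
                  ; ∙-cong = λ {f} {f'} {g} {g'} e e' → wrap (⊕-cong {f} {f'} {g} {g'} (unwrap e) (unwrap e')) }
                ; assoc = λ f g h → wrap (⊕-assoc f g h) }
              ; identity = (λ f → wrap (≈-refl {f})) , (λ f → wrap (⊕-identityʳ f)) }
            ; inverse = (λ f → wrap (neg-inverseˡ f)) , (λ f → wrap (neg-inverseʳ f))
            ; ⁻¹-cong = λ {f} {g} e → wrap (neg-cong {f} {g} (unwrap e)) }
          ; comm = λ f g → wrap (⊕-comm f g) }
        ; *-cong = λ {f} {f'} {g} {g'} e e' → wrap (⊗-cong {f} {f'} {g} {g'} (unwrap e) (unwrap e'))
        ; *-assoc = λ f g h → wrap (⊗-assoc f g h)
        ; *-identity = (λ f → wrap (one-⊗ f)) , (λ f → wrap (⊗-identityʳ f))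
        ; distrib = (λ f g h → wrap (⊗-distribˡ f g h)) , (λ f g h → wrap (⊗-distribʳ f g h)) }
      ; *-comm = λ f g → wrap (⊗-comm f g) } }

open IntegerEmbedding
open SymIsRing

module SymConstants where
  ιSym : ℤ → Sym
  ιSym z = const (ℤ→ℚ z)

  const-+ : ∀ a b → const (a ℚ.+ b) ≈ const a ⊕ const b
  const-+ a b m = ≡.trans (by-cases (eqMono [] m)) (≡.sym (coeff-⊕ (const a) (const b) m))
    where
    by-cases : ∀ t → (if t then a ℚ.+ b else 0ℚ) ℚ.+ 0ℚ
                   ≡ ((if t then a else 0ℚ) ℚ.+ 0ℚ) ℚ.+ ((if t then b else 0ℚ) ℚ.+ 0ℚ)
    by-cases true  = ≡.trans (ℚP.+-identityʳ (a ℚ.+ b))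
                       (≡.cong₂ ℚ._+_ (≡.sym (ℚP.+-identityʳ a)) (≡.sym (ℚP.+-identityʳ b)))
    by-cases false = ≡.refl

  ιSym-+ : ∀ a b → ιSym (a ℤ.+ b) ≋ ιSym a ⊕ ιSym b
  ιSym-+ a b = wrap λ m → ≡.trans (≡.cong (λ u → coeff (const u) m) (ℤ→ℚ-+ a b)) (const-+ (ℤ→ℚ a) (ℤ→ℚ b) m)

  ιSym-* : ∀ a b → ιSym (a ℤ.* b) ≋ ιSym a ⊗ ιSym b
  ιSym-* a b = wrap λ m → ≡.cong (λ u → coeff (const u) m) (ℤ→ℚ-* a b)

  ιSym-1 : ιSym (+ 1) ≋ one
  ιSym-1 = wrap λ m → ≡.refl

  ιSym-0 : ιSym (+ 0) ≋ []
  ιSym-0 = wrap λ m → by-cases (eqMono [] m)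
    where
    by-cases : ∀ t → (if t then 0ℚ else 0ℚ) ℚ.+ 0ℚ ≡ 0ℚ
    by-cases true  = ≡.refl
    by-cases false = ≡.refl

  ·-as-⊗ : ∀ c f → c · f ≋ const c ⊗ f
  ·-as-⊗ c f = wrap λ m → ≡.trans (coeff-· c f m) (≡.sym (≡.trans (coeff-⊗ (const c) f m)
    (≡.trans (ℚP.+-identityʳ _) (≡.cong (c ℚ.*_) (ℚP.*-identityˡ (coeff f m))))))

module SymProductRule where
  open SymConstants
  open WithIntegers SymRing ιSym ιSym-+ ιSym-* ιSym-1 ιSym-0
  open CommutativeRing SymRing
    using (setoid; reflexive; +-cong; *-cong) renaming (refl to ≋-refl; sym to ≋-sym; trans to ≋-trans)
  open import Relation.Binary.Reasoning.Setoid setoid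

  ·-as-ι : ∀ z f g → f ≋ g → ℤ→ℚ z · f ≋ ιSym z ⊗ g
  ·-as-ι z f g e = ≋-trans (·-as-⊗ (ℤ→ℚ z) f) (*-cong {ιSym z} {ιSym z} {f} {g} ≋-refl e)

  sumSym-Σ : ∀ n f → sumSym (map f (upTo n)) ≋ Σ n f
  sumSym-Σ n f = ≋-trans (reflexive (≡.cong (foldr _⊕_ []) (map-upTo f n))) (foldr-Σ n f)
    where
    foldr-Σ : ∀ n f → foldr _⊕_ [] (applyUpTo f n) ≋ Σ n f
    foldr-Σ zero    f = ≋-sym (Σ-empty f)
    foldr-Σ (suc n) f = ≋-trans (+-cong ≋-refl (foldr-Σ n (λ k → f (suc k)))) (≋-sym (Σ-suc n f))

  ιSym-Σℤ≤ : ∀ n f → ιSym (Σℤ≤ n f) ≋ Σ (suc n) (λ k → ιSym (f k))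
  ιSym-Σℤ≤ n f = ≋-trans (ι-cong (≡.cong (foldr ℤ._+_ (+ 0)) (map-upTo f (suc n)))) (foldr-Σ (suc n) f)
    where
    foldr-Σ : ∀ n f → ιSym (foldr ℤ._+_ (+ 0) (applyUpTo f n)) ≋ Σ n (λ k → ιSym (f k))
    foldr-Σ zero    f = ≋-trans ιSym-0 (≋-sym (Σ-empty _))
    foldr-Σ (suc n) f = ≋-trans (ιSym-+ (f 0) _) (≋-trans (+-cong ≋-refl (foldr-Σ n (λ k → f (suc k)))) (≋-sym (Σ-suc n _)))

  falling≋fall : ∀ x n → falling x n ≋ FallingFactorials.fall x n
  falling≋fall x zero    = ≋-refl
  falling≋fall x (suc n) = *-cong (falling≋fall x n) (wrap (λ m → ≡.cong (λ u → coeff (x ⊕ const u) m) (negate n)))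
    where
    negate : ∀ n → ℚ.- ℕ→ℚ n ≡ ℤ→ℚ (ℤ.- (+ n))
    negate zero    = ≡.refl
    negate (suc n) = ≡.refl

  module _ (i : ℕ) where
    open ProductRule i (q i)

    pbar≋P̄ : ∀ k → pbar i k ≋ P̄ k
    pbar≋P̄ zero    = wrap (≈-sym {P̄ 0} {one} (one-⊗ one))
    pbar≋P̄ (suc n) = ·-as-ι (+ (i ^ suc n)) _ _ (falling≋fall (q i) (suc n))

    bp≋P : ∀ r → bp i r ≋ P r
    bp≋P r = begin
      bp i r
        ≈⟨ sumSym-Σ (suc r) _ ⟩
      Σ (suc r) (λ k → ℤ→ℚ (sgn (r ∸ k) ℤ.* + (r C k)) · pbar i k)
        ≈⟨ Σ-cong′ (suc r) (λ k → ≋-trans (·-as-ι (sgn (r ∸ k) ℤ.* + (r C k)) _ _ (pbar≋P̄ k))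
                                           (*-cong (ι-cong (≡.cong (λ u → sgn (r ∸ k) ℤ.* + u) (≡.sym (bin≡C r k)))) ≋-refl)) ⟩
      P r ∎

    summand : ℕ → ℕ → ℕ → ℕ → ℕ → ℕ → ℤ
    summand r s a l d k = sgn ((r ℕ.+ s) ∸ (l ℕ.+ d)) ℤ.*
      + ((r C l) ℕ.* (s C d) ℕ.* (l C k) ℕ.* (d C k) ℕ.* (((l ℕ.+ d) ∸ k) C a) ℕ.* (k !) ℕ.* (i ^ k))

    cCoef-summand : ∀ r s a l d k → l ≤ r → d ≤ s → summand r s a l d k ≡ weight r s l d k a
    cCoef-summand r s a l d k l≤r d≤s = ≡.trans
      (≡.cong₂ ℤ._*_ (sgn-∸-+ r s l d l≤r d≤s) (≡.cong +_ binomials))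
      (signs-and-sizes (sgn (r ∸ l)) (sgn (s ∸ d)) (bin r l) (bin s d) (matchings d l k ℕ.* i ^ k) (bin (l ℕ.+ d ∸ k) a))
      where
      regroup : ∀ A B C D E F G → A ℕ.* B ℕ.* C ℕ.* D ℕ.* E ℕ.* F ℕ.* G ≡ A ℕ.* B ℕ.* (D ℕ.* C ℕ.* F ℕ.* G) ℕ.* E
      regroup = solve-∀
      binomials : (r C l) ℕ.* (s C d) ℕ.* (l C k) ℕ.* (d C k) ℕ.* (((l ℕ.+ d) ∸ k) C a) ℕ.* (k !) ℕ.* (i ^ k)
                ≡ bin r l ℕ.* bin s d ℕ.* (matchings d l k ℕ.* i ^ k) ℕ.* bin (l ℕ.+ d ∸ k) a
      binomials rewrite ≡.sym (bin≡C r l) | ≡.sym (bin≡C s d) | ≡.sym (bin≡C l k) | ≡.sym (bin≡C d k)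
                      | ≡.sym (bin≡C (l ℕ.+ d ∸ k) a) =
        regroup (bin r l) (bin s d) (bin l k) (bin d k) (bin (l ℕ.+ d ∸ k) a) (k !) (i ^ k)
      signs-and-sizes : ∀ (S T : ℤ) (p₁ p₂ p₃ p₄ : ℕ) →
        (S ℤ.* T) ℤ.* + (p₁ ℕ.* p₂ ℕ.* p₃ ℕ.* p₄) ≡ (S ℤ.* + p₁) ℤ.* (T ℤ.* + p₂) ℤ.* + p₃ ℤ.* + p₄
      signs-and-sizes S T p₁ p₂ p₃ p₄ = ≡.trans (≡.cong ((S ℤ.* T) ℤ.*_) pos-*₄)
        (solve 6 (λ S T a b c d → (S :* T) :* (a :* b :* c :* d) := (S :* a) :* (T :* b) :* c :* d)
          ≡.refl S T (+ p₁) (+ p₂) (+ p₃) (+ p₄))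
        where
        open ℤSolver.+-*-Solver
        pos-*₄ : + (p₁ ℕ.* p₂ ℕ.* p₃ ℕ.* p₄) ≡ + p₁ ℤ.* + p₂ ℤ.* + p₃ ℤ.* + p₄
        pos-*₄ = ≡.trans (ℤP.pos-* (p₁ ℕ.* p₂ ℕ.* p₃) p₄)
          (≡.cong (ℤ._* + p₄) (≡.trans (ℤP.pos-* (p₁ ℕ.* p₂) p₃) (≡.cong (ℤ._* + p₃) (ℤP.pos-* p₁ p₂))))

    cCoef≋coefficient : ∀ r s a → ιSym (cCoef i r s a) ≋ coefficient r s a
    cCoef≋coefficient r s a =
      ≋-trans (ιSym-Σℤ≤ r (λ l → Σℤ≤ s λ d → Σℤ≤ l (summand r s a l d))) (Σ-cong (suc r) (λ l l<r →
        ≋-trans (ιSym-Σℤ≤ s (λ d → Σℤ≤ l (summand r s a l d))) (Σ-cong (suc s) (λ d d<s →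
        ≋-trans (ιSym-Σℤ≤ l (summand r s a l d)) (Σ-cong′ (suc l) (λ k →
          ι-cong (cCoef-summand r s a l d k (ℕP.≤-pred l<r) (ℕP.≤-pred d<s))))))))

    bp-product : ∀ r s → bp i r ⊗ bp i s ≋ sumSym (map (λ a → ℤ→ℚ (cCoef i r s a) · bp i a) (upTo (suc (r ℕ.+ s))))
    bp-product r s = begin
      bp i r ⊗ bp i s                                   ≈⟨ *-cong (bp≋P r) (bp≋P s) ⟩
      P r ⊗ P s                                         ≈⟨ P-product r s ⟩
      Σ (suc (r ℕ.+ s)) (λ a → coefficient r s a ⊗ P a)
        ≈⟨ Σ-cong′ (suc (r ℕ.+ s)) (λ a → ≋-sym (≋-trans (·-as-ι (cCoef i r s a) _ _ (bp≋P a))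
                                                            (*-cong (cCoef≋coefficient r s a) ≋-refl))) ⟩
      Σ (suc (r ℕ.+ s)) (λ a → ℤ→ℚ (cCoef i r s a) · bp i a)
        ≈⟨ ≋-sym (sumSym-Σ (suc (r ℕ.+ s)) _) ⟩
      sumSym (map (λ a → ℤ→ℚ (cCoef i r s a) · bp i a) (upTo (suc (r ℕ.+ s)))) ∎

-- Inserting r parts equal to i into a partition without parts i multiplies
-- 𝐩_γ by 𝐩_{i^r}.  `bpPart' j γ` is the product over the parts ≥ j, and we
-- induct on the distance t = i - j.
module AddingParts where
  open CommutativeRing SymRing
    using (setoid; *-congˡ; *-congʳ; *-identityˡ; *-commutativeSemigroup)
    renaming (refl to ≋-refl; sym to ≋-sym; trans to ≋-trans)
  open import Relation.Binary.Reasoning.Setoid setoid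
  open import Algebra.Properties.CommutativeSemigroup *-commutativeSemigroup using (x∙yz≈y∙xz)

  bp-zero-⊗ : ∀ j f → bp j 0 ⊗ f ≋ f
  bp-zero-⊗ j f = ≋-trans (*-congʳ {f} {bp j 0} {one} (wrap (λ m → ≡.refl))) (*-identityˡ f)

  -- For the tail γ whose head counts the parts equal to j, position t counts
  -- the parts equal to t + j.
  bp-⊗-bpPart' : ∀ t j r γ → mult (suc t) γ ≡ 0 →
    bp (t ℕ.+ j) r ⊗ bpPart' j γ ≋ bpPart' j (addParts (suc t) r γ)
  bp-⊗-bpPart' zero j r []      _      = ≋-refl
  bp-⊗-bpPart' zero j r (m ∷ γ) ≡.refl = begin
    bp j r ⊗ (bp j 0 ⊗ bpPart' (suc j) γ)   ≈⟨ *-congˡ {bp j r} (bp-zero-⊗ j (bpPart' (suc j) γ)) ⟩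
    bp j r ⊗ bpPart' (suc j) γ              ≡⟨ ≡.cong (λ u → bp j u ⊗ bpPart' (suc j) γ) (≡.sym (ℕP.+-identityʳ r)) ⟩
    bp j (r ℕ.+ 0) ⊗ bpPart' (suc j) γ ∎
  bp-⊗-bpPart' (suc t) j r []      γ₀ = begin
    bp (suc t ℕ.+ j) r ⊗ one                             ≡⟨ ≡.cong (λ u → bp u r ⊗ one) (≡.sym (ℕP.+-suc t j)) ⟩
    bp (t ℕ.+ suc j) r ⊗ bpPart' (suc j) []              ≈⟨ bp-⊗-bpPart' t (suc j) r [] γ₀ ⟩
    bpPart' (suc j) (addParts (suc t) r [])              ≈⟨ ≋-sym (bp-zero-⊗ j (bpPart' (suc j) (addParts (suc t) r []))) ⟩
    bp j 0 ⊗ bpPart' (suc j) (addParts (suc t) r []) ∎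
  bp-⊗-bpPart' (suc t) j r (m ∷ γ) γ₀ = begin
    bp (suc t ℕ.+ j) r ⊗ (bp j m ⊗ bpPart' (suc j) γ)    ≈⟨ x∙yz≈y∙xz (bp (suc t ℕ.+ j) r) (bp j m) (bpPart' (suc j) γ) ⟩
    bp j m ⊗ (bp (suc t ℕ.+ j) r ⊗ bpPart' (suc j) γ)
      ≡⟨ ≡.cong (λ u → bp j m ⊗ (bp u r ⊗ bpPart' (suc j) γ)) (≡.sym (ℕP.+-suc t j)) ⟩
    bp j m ⊗ (bp (t ℕ.+ suc j) r ⊗ bpPart' (suc j) γ)    ≈⟨ *-congˡ {bp j m} (bp-⊗-bpPart' t (suc j) r γ γ₀) ⟩
    bp j m ⊗ bpPart' (suc j) (addParts (suc t) r γ) ∎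

  bp-⊗-bpPart : ∀ i r → 1 ≤ i → (γ : Partition) → mult i γ ≡ 0 →
    bp i r ⊗ bpPart γ ≋ bpPart (addParts i r γ)
  bp-⊗-bpPart (suc t) r _ γ γ₀ = begin
    bp (suc t) r ⊗ bpPart' 1 γ    ≡⟨ ≡.cong (λ u → bp u r ⊗ bpPart' 1 γ) (ℕP.+-comm 1 t) ⟩
    bp (t ℕ.+ 1) r ⊗ bpPart' 1 γ  ≈⟨ bp-⊗-bpPart' t 1 r γ γ₀ ⟩
    bpPart' 1 (addParts (suc t) r γ) ∎

-- Both identities; the product rule in fact holds for all r, s ≥ 0.
mainTheorem4 : (i r s : ℕ) → 1 ≤ i → 1 ≤ r → 1 ≤ s →
    (bp i r ⊗ bp i s
      ≈ sumSym (map (λ a → ℤ→ℚ (cCoef i r s a) · bp i a) (upTo (1 ℕ.+ (r ℕ.+ s)))))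
    × ((γ : Partition) → mult i γ ≡ 0 → bp i r ⊗ bpPart γ ≈ bpPart (addParts i r γ))
mainTheorem4 i r s 1≤i _ _ =
    unwrap (SymProductRule.bp-product i r s)
  , λ γ γ₀ → unwrap (AddingParts.bp-⊗-bpPart i r 1≤i γ γ₀)
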